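{- An $\varepsilon$-approximately $k$-submodular function need not be $\varepsilon$-approximately diminishing returns: there exist $\varepsilon>0$, a finite set $V$, an integer $k\ge1$ and a function $F:(k+1)^V\to\mathbb{R}_{\ge0}$ that is $\varepsilon$-approximately $k$-submodular but not $\varepsilon$-approximately diminishing returns.
   Context: $(k+1)^V$ denotes the set of $k$-tuples $\mathbf{x}=(X_1,\dots,X_k)$ of pairwise disjoint subsets of $V$; $\mathbf{0}=(\emptyset,\dots,\emptyset)$; $\mathrm{supp}(\mathbf{x})=\bigcup_iX_i$; $\mathbf{x}\preceq\mathbf{y}$ means $X_i\subseteq Y_i$ for all $i$. For $g:(k+1)^V\to\mathbb{R}$, $u\notin\mathrm{supp}(\mathbf{x})$, $i\in[k]$: $\Delta_{u,i}g(\mathbf{x})=g(X_1,\dots,X_i\cup\{u\},\dots,X_k)-g(\mathbf{x})$. $f$ is $k$-submodular if (a) $\Delta_{u,i}f(\mathbf{x})\ge\Delta_{u,i}f(\mathbf{y})$ whenever $\mathbf{x}\preceq\mathbf{y}$, $u\notin\mathrm{supp}(\mathbf{y})$, and (b) $\Delta_{u,i}f(\mathbf{x})+\Delta_{u,j}f(\mathbf{x})\ge0$ for $i\ne j$; monotone if $\mathbf{x}\preceq\mathbf{y}\Rightarrow f(\mathbf{x})\le f(\mathbf{y})$; functions are normalized with value $0$ at $\mathbf{0}$. $F$ is $\varepsilon$-approximately $k$-submodular if there is a monotone $k$-submodular $f$ with $(1-\varepsilon)f(\mathbf{x})\le F(\mathbf{x})\le(1+\varepsilon)f(\mathbf{x})$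 for all $\mathbf{x}$; $F$ is $\varepsilon$-approximately diminishing returns if there is a monotone $k$-submodular $f$ with $(1-\varepsilon)\Delta_{u,i}f(\mathbf{x})\le\Delta_{u,i}F(\mathbf{x})\le(1+\varepsilon)\Delta_{u,i}f(\mathbf{x})$ for all $\mathbf{x}$, $u\notin\mathrm{supp}(\mathbf{x})$, $i\in[k]$.
   Formalization: The number ε is rational, and F and the monotone k-submodular functions f in both approximation notions take values in ℚ rather than in ℝ. -}

module Defs where

open import Data.Nat using (ℕ; zero; suc)
open import Data.Fin using (Fin; zero; suc)
open import Data.Vec using (Vec; lookup; replicate; _[_]≔_)
open import Data.Rational using (ℚ; 0ℚ; 1ℚ; _+_; _-_; _*_; _≤_)
open import Data.Product using (Σ; _×_; ∃)
open import Relation.Binary.PropositionalEquality using (_≡_; _≢_)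

-- (k+1)^V with V = Fin n: a k-tuple (X_1,…,X_k) of pairwise disjoint subsets
-- of V is encoded as x : V → {0,…,k} (stored as a vector), where
-- lookup x v ≡ zero  iff v ∉ supp(x), and lookup x v ≡ suc i iff v ∈ X_{i+1}.
Orth : ℕ → ℕ → Set
Orth n k = Vec (Fin (suc k)) n

𝟎 : ∀ {n k} → Orth n k
𝟎 {n} = replicate n zero

_∉supp_ : ∀ {n k} → Fin n → Orth n k → Set
u ∉supp x = lookup x u ≡ zero

_⪯_ : ∀ {n k} → Orth n k → Orth n k → Set
x ⪯ y = ∀ v → lookup x v ≢ zero → lookup y v ≡ lookup x v

-- add u to the i-th set (i : Fin k, i.e. index i+1 in 1-based notation)
addTo : ∀ {n k} → Orth n k → Fin n → Fin k → Orth n k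
addTo x u i = x [ u ]≔ suc i

Δ : ∀ {n k} → (Orth n k → ℚ) → Orth n k → Fin n → Fin k → ℚ
Δ g x u i = g (addTo x u i) - g x

Normalized : ∀ {n k} → (Orth n k → ℚ) → Set
Normalized f = f 𝟎 ≡ 0ℚ

Monotone : ∀ {n k} → (Orth n k → ℚ) → Set
Monotone f = ∀ x y → x ⪯ y → f x ≤ f y

KSubmodular : ∀ {n k} → (Orth n k → ℚ) → Set
KSubmodular {n} {k} f =
  (∀ (x y : Orth n k) (u : Fin n) (i : Fin k) → x ⪯ y → u ∉supp y →
     Δ f y u i ≤ Δ f x u i)
  × (∀ (x : Orth n k) (u : Fin n) (i j : Fin k) → u ∉supp x → i ≢ j →
     0ℚ ≤ Δ f x u i + Δ f x u j)

MonoKSub : ∀ {n k} → (Orth n k → ℚ) → Set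
MonoKSub f = Normalized f × Monotone f × KSubmodular f

ApproxKSubmodular : ∀ {n k} → ℚ → (Orth n k → ℚ) → Set
ApproxKSubmodular {n} {k} ε F = Σ (Orth n k → ℚ) λ f → MonoKSub f ×
  (∀ x → ((1ℚ - ε) * f x ≤ F x) × (F x ≤ (1ℚ + ε) * f x))

ApproxDR : ∀ {n k} → ℚ → (Orth n k → ℚ) → Set
ApproxDR {n} {k} ε F = Σ (Orth n k → ℚ) λ f → MonoKSub f ×
  (∀ x u i → u ∉supp x →
     ((1ℚ - ε) * Δ f x u i ≤ Δ F x u i) × (Δ F x u i ≤ (1ℚ + ε) * Δ f x u i))

-- Take ε = ½, k = 1 and V = {u₀, u₁}. The function F with F ∅ = 0, F {u₀} = F {u₁} = ½
-- and F V = 3 lies within a factor 1 ± ½ of the cardinality function, which is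
-- monotone and k-submodular. But approximate diminishing returns with respect
-- to any monotone k-submodular f transfers diminishing returns to F up to the
-- factor (1 + ε)/(1 − ε) = 3, whereas adding u₁ gains ½ at ∅ and 5/2 at {u₀}.
module Submission where

open import Defs
open import Data.Nat using (ℕ)
open import Data.Nat as ℕ using ()
open import Data.Rational using (ℚ; 0ℚ; _<_; _≤_)
open import Data.Product using (Σ; _×_)
open import Relation.Nullary using (¬_)

open import Data.Empty using (⊥-elim)
open import Data.Fin using (Fin; zero; suc)
open import Data.Fin.Properties using (0≢1+n)
open import Data.Integer using (+_)
open import Data.Product using (_,_; proj₁; proj₂)
open import Data.Rational using (1ℚ; ½; _+_; _-_; _*_; _/_; NonNegative; nonNegative)
open import Data.Rational.Properties
open import Algebra.Bundles using (CommutativeMonoid)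
open import Algebra.Properties.AbelianGroup +-0-abelianGroup using (xyx⁻¹≈y)
open import Algebra.Properties.CommutativeSemigroup
  (CommutativeMonoid.commutativeSemigroup *-1-commutativeMonoid) using (x∙yz≈y∙xz)
open import Data.Vec using (_∷_; []; lookup)
open import Data.Vec.Properties using (lookup-replicate)
open import Relation.Nullary.Decidable using (True; False; toWitness; toWitnessFalse)
open import Relation.Binary.PropositionalEquality using (_≡_; _≢_; refl; sym; trans; cong; module ≡-Reasoning)
open import Function using (_∘_)

decide-< : ∀ {p q : ℚ} {p<q : True (p <? q)} → p < q
decide-< {p<q = p<q} = toWitness p<q

decide-≤ : ∀ {p q : ℚ} {p≤q : True (p ≤? q)} → p ≤ q
decide-≤ {p≤q = p≤q} = toWitness p≤q

refute-≤ : ∀ {p q : ℚ} {p≰q : False (p ≤? q)} → ¬ p ≤ q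
refute-≤ {p≰q = p≰q} = toWitnessFalse p≰q

𝟎-least : ∀ {n k} (x : Orth n k) → 𝟎 ⪯ x
𝟎-least x v 𝟎ᵥ≢0 = ⊥-elim (𝟎ᵥ≢0 (lookup-replicate v zero))

∉supp-antitone : ∀ {n k} {x y : Orth n k} {u} → x ⪯ y → u ∉supp y → u ∉supp x
∉supp-antitone {x = x} {y} {u} x⪯y u∉y with lookup x u in xᵤ
... | zero  = refl
... | suc i = ⊥-elim (0≢1+n (trans (sym u∉y) yᵤ))
  where
  yᵤ : lookup y u ≡ suc i
  yᵤ = trans (x⪯y u λ xᵤ≡0 → 0≢1+n (trans (sym xᵤ≡0) xᵤ)) xᵤ

occupied : ∀ {k} → Fin (ℕ.suc k) → ℚ
occupied zero    = 0ℚ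
occupied (suc _) = 1ℚ

∣supp∣ : ∀ {n k} → Orth n k → ℚ
∣supp∣ []      = 0ℚ
∣supp∣ (a ∷ x) = occupied a + ∣supp∣ x

∣supp∣-addTo : ∀ {n k} (x : Orth n k) u i → u ∉supp x →
               ∣supp∣ (addTo x u i) ≡ ∣supp∣ x + 1ℚ
∣supp∣-addTo (zero ∷ x) zero i refl =
  trans (+-comm 1ℚ (∣supp∣ x)) (cong (_+ 1ℚ) (sym (+-identityˡ (∣supp∣ x))))
∣supp∣-addTo (a ∷ x) (suc u) i u∉x =
  trans (cong (_+_ (occupied a)) (∣supp∣-addTo x u i u∉x))
        (sym (+-assoc (occupied a) (∣supp∣ x) 1ℚ))

Δ∣supp∣ : ∀ {n k} (x : Orth n k) u i → u ∉supp x → Δ ∣supp∣ x u i ≡ 1ℚ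
Δ∣supp∣ x u i u∉x = begin
  ∣supp∣ (addTo x u i) - ∣supp∣ x  ≡⟨ cong (_- ∣supp∣ x) (∣supp∣-addTo x u i u∉x) ⟩
  ∣supp∣ x + 1ℚ - ∣supp∣ x         ≡⟨ xyx⁻¹≈y (∣supp∣ x) 1ℚ ⟩
  1ℚ                               ∎
  where open ≡-Reasoning

∣supp∣-𝟎 : ∀ {n k} → Normalized {n} {k} ∣supp∣
∣supp∣-𝟎 {ℕ.zero}  = refl
∣supp∣-𝟎 {ℕ.suc n} {k} = trans (+-identityˡ (∣supp∣ (𝟎 {n} {k}))) (∣supp∣-𝟎 {n})

occupied-monotone : ∀ {k} (a b : Fin (ℕ.suc k)) → (a ≢ zero → b ≡ a) → occupied a ≤ occupied b
occupied-monotone zero    zero    _   = decide-≤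
occupied-monotone zero    (suc _) _   = decide-≤
occupied-monotone (suc _) b       b≡a with refl ← b≡a (0≢1+n ∘ sym) = ≤-refl

∣supp∣-monotone : ∀ {n k} → Monotone {n} {k} ∣supp∣
∣supp∣-monotone []      []      _     = ≤-refl
∣supp∣-monotone (a ∷ x) (b ∷ y) ax⪯by =
  +-mono-≤ (occupied-monotone a b (ax⪯by zero)) (∣supp∣-monotone x y (ax⪯by ∘ suc))

∣supp∣-kSubmodular : ∀ {n k} → KSubmodular {n} {k} ∣supp∣
∣supp∣-kSubmodular = diminishing , orthantwise
  where
  diminishing : ∀ x y u i → x ⪯ y → u ∉supp y → Δ ∣supp∣ y u i ≤ Δ ∣supp∣ x u i
  diminishing x y u i x⪯y u∉y = ≤-reflexive
    (trans (Δ∣supp∣ y u i u∉y) (sym (Δ∣supp∣ x u i (∉supp-antitone {x = x} {y} x⪯y u∉y))))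
  orthantwise : ∀ x u i j → u ∉supp x → i ≢ j → 0ℚ ≤ Δ ∣supp∣ x u i + Δ ∣supp∣ x u j
  orthantwise x u i j u∉x _ rewrite Δ∣supp∣ x u i u∉x | Δ∣supp∣ x u j u∉x = decide-≤

∣supp∣-monoKSub : ∀ {n k} → MonoKSub {n} {k} ∣supp∣
∣supp∣-monoKSub {n} {k} = ∣supp∣-𝟎 {n} {k} , ∣supp∣-monotone , ∣supp∣-kSubmodular

approxDR⇒approxDiminishing : ∀ {n k} {ε} {F : Orth n k → ℚ} →
  0ℚ ≤ 1ℚ - ε → 0ℚ ≤ 1ℚ + ε → ApproxDR ε F →
  ∀ x y u i → x ⪯ y → u ∉supp y → (1ℚ - ε) * Δ F y u i ≤ (1ℚ + ε) * Δ F x u i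
approxDR⇒approxDiminishing {ε = ε} {F} 0≤1-ε 0≤1+ε (f , (_ , _ , (f-diminishing , _)) , Δf≈ΔF)
  x y u i x⪯y u∉y = begin
    (1ℚ - ε) * Δ F y u i               ≤⟨ *-monoˡ-≤-nonNeg (1ℚ - ε) ΔFy≤ ⟩
    (1ℚ - ε) * ((1ℚ + ε) * Δ f y u i)  ≤⟨ *-monoˡ-≤-nonNeg (1ℚ - ε) (*-monoˡ-≤-nonNeg (1ℚ + ε) Δfy≤Δfx) ⟩
    (1ℚ - ε) * ((1ℚ + ε) * Δ f x u i)  ≡⟨ x∙yz≈y∙xz (1ℚ - ε) (1ℚ + ε) (Δ f x u i) ⟩
    (1ℚ + ε) * ((1ℚ - ε) * Δ f x u i)  ≤⟨ *-monoˡ-≤-nonNeg (1ℚ + ε) ≤ΔFx ⟩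
    (1ℚ + ε) * Δ F x u i               ∎
  where
  open ≤-Reasoning
  instance
    1-ε-nonNegative : NonNegative (1ℚ - ε)
    1-ε-nonNegative = nonNegative 0≤1-ε
    1+ε-nonNegative : NonNegative (1ℚ + ε)
    1+ε-nonNegative = nonNegative 0≤1+ε
  ΔFy≤ : Δ F y u i ≤ (1ℚ + ε) * Δ f y u i
  ΔFy≤ = proj₂ (Δf≈ΔF y u i u∉y)
  Δfy≤Δfx : Δ f y u i ≤ Δ f x u i
  Δfy≤Δfx = f-diminishing x y u i x⪯y u∉y
  ≤ΔFx : (1ℚ - ε) * Δ f x u i ≤ Δ F x u i
  ≤ΔFx = proj₁ (Δf≈ΔF x u i (∉supp-antitone {x = x} {y} x⪯y u∉y))

F : Orth 2 1 → ℚ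
F (zero  ∷ zero  ∷ []) = 0ℚ
F (zero  ∷ suc _ ∷ []) = ½
F (suc _ ∷ zero  ∷ []) = ½
F (suc _ ∷ suc _ ∷ []) = + 3 / 1

F-nonNegative : ∀ x → 0ℚ ≤ F x
F-nonNegative (zero  ∷ zero  ∷ []) = decide-≤
F-nonNegative (zero  ∷ suc _ ∷ []) = decide-≤
F-nonNegative (suc _ ∷ zero  ∷ []) = decide-≤
F-nonNegative (suc _ ∷ suc _ ∷ []) = decide-≤

F≈∣supp∣ : ∀ x → ((1ℚ - ½) * ∣supp∣ x ≤ F x) × (F x ≤ (1ℚ + ½) * ∣supp∣ x)
F≈∣supp∣ (zero  ∷ zero  ∷ []) = decide-≤ , decide-≤
F≈∣supp∣ (zero  ∷ suc _ ∷ []) = decide-≤ , decide-≤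
F≈∣supp∣ (suc _ ∷ zero  ∷ []) = decide-≤ , decide-≤
F≈∣supp∣ (suc _ ∷ suc _ ∷ []) = decide-≤ , decide-≤

F-not-approxDR : ¬ ApproxDR ½ F
F-not-approxDR F-DR = refute-≤
  (approxDR⇒approxDiminishing {ε = ½} {F} decide-≤ decide-≤ F-DR
     𝟎 only-u₀ u₁ zero (𝟎-least only-u₀) refl)
  where
  u₁ : Fin 2
  u₁ = suc zero
  only-u₀ : Orth 2 1
  only-u₀ = addTo 𝟎 zero zero

theorem2 : Σ ℚ λ ε → (0ℚ < ε) × Σ ℕ λ n → Σ ℕ λ k → (1 ℕ.≤ k) ×
    Σ (Orth n k → ℚ) λ F → (∀ x → 0ℚ ≤ F x) × Normalized F ×
    ApproxKSubmodular ε F × ¬ ApproxDR ε F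
theorem2 = ½ , decide-< , 2 , 1 , ℕ.s≤s ℕ.z≤n ,
  F , F-nonNegative , refl , (∣supp∣ , ∣supp∣-monoKSub , F≈∣supp∣) , F-not-approxDR
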